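{- (Weakening) In the multirole logic MRL over a set of roles $\mathcal{R}$, for every sequent $\Gamma$, every set $R\subseteq\mathcal{R}$ and every formula $A$: if $\vdash\Gamma$ is derivable, then $\vdash\Gamma,[R]A$ is derivable.
   Context: Fix a set $\mathcal{R}$ (the set of roles), possibly infinite. For $R\subseteq\mathcal{R}$ write $\overline{R}=\mathcal{R}\setminus R$. Writing $R_1\uplus\cdots\uplus R_n$ means the union of the pairwise disjoint sets $R_1,\dots,R_n$ (the notation asserts disjointness). A filter on $\mathcal{R}$ is a set $\mathcal{F}$ of subsets of $\mathcal{R}$ with $\mathcal{R}\in\mathcal{F}$, such that $R_1\in\mathcal{F}$ and $R_1\subseteq R_2$ imply $R_2\in\mathcal{F}$, and $R_1,R_2\in\mathcal{F}$ imply $R_1\cap R_2\in\mathcal{F}$; an ultrafilter $\mathcal{U}$ is a filter such that for every $R\subseteq\mathcal{R}$, $R\in\mathcal{U}$ or $\overline{R}\in\mathcal{U}$. An endomorphism is any function $f:\mathcal{R}\to\mathcal{R}$, and $f^{ -1}(R)$ is the preimage. First-order terms $t$ and atomic formulas $a$ are standard. Formulas of MRL: $A ::= a \mid \neg_f(A) \mid A_1\wedge_{\mathcal{U}}A_2 \mid A\supset_{f,\mathcal{U}}B \mid \forall_{\mathcal{U}}(\lambda x.A)$, with $f$ an endomorphism and $\mathcal{U}$ an ultrafilter on $\mathcal{R}$; $A[x:=t]$ is substitution. An i-formula is $[R]A$ with $R\subseteq\mathcal{R}$ and $A$ a formula. A sequent $\Gamma$ is a finite multiset of i-formulas; commas denote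 multiset union. Derivable sequents $\vdash\Gamma$ are generated by the rules: (Id) $\vdash\Gamma,[R_1]a,\dots,[R_n]a$ for any $\Gamma$, atomic $a$, $n\ge1$ and $R_1\uplus\cdots\uplus R_n=\mathcal{R}$; (contraction) from $\vdash\Gamma,[R]A,[R]A$ infer $\vdash\Gamma,[R]A$; ($\neg$) from $\vdash\Gamma,[f^{ -1}(R)]A$ infer $\vdash\Gamma,[R]\neg_f(A)$; ($\wedge$-neg) if $R\notin\mathcal{U}$, from $\vdash\Gamma,[R]A$ or from $\vdash\Gamma,[R]B$ infer $\vdash\Gamma,[R](A\wedge_{\mathcal{U}}B)$; ($\wedge$-pos) if $R\in\mathcal{U}$, from $\vdash\Gamma,[R]A$ and $\vdash\Gamma,[R]B$ infer $\vdash\Gamma,[R](A\wedge_{\mathcal{U}}B)$; ($\supset$-neg) if $R\notin\mathcal{U}$, from $\vdash\Gamma,[f^{ -1}(R)]A,[R]B$ infer $\vdash\Gamma,[R](A\supset_{f,\mathcal{U}}B)$; ($\supset$-pos) if $R\in\mathcal{U}$, from $\vdash\Gamma_1,[f^{ -1}(R)]A$ and $\vdash\Gamma_2,[R]B$ infer $\vdash\Gamma_1,\Gamma_2,[R](A\supset_{f,\mathcal{U}}B)$; ($\forall$-neg) if $R\notin\mathcal{U}$, from $\vdash\Gamma,[R]A[x:=t]$ for some term $t$ infer $\vdash\Gamma,[R]\forall_{\mathcal{U}}(\lambda x.A)$; ($\forall$-pos) if $R\in\mathcal{U}$ and $x$ has no free occurrence in $\Gamma$, from $\vdash\Gamma,[R]A$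 infer $\vdash\Gamma,[R]\forall_{\mathcal{U}}(\lambda x.A)$. -}

module Defs where

open import Level using (0ℓ)
open import Data.Nat using (ℕ; zero; suc)
open import Data.Vec using (Vec; []; _∷_)
open import Data.List using (List; []; _∷_; _++_; map)
open import Data.List.Relation.Unary.Any using (Any)
open import Data.List.Relation.Binary.Permutation.Propositional using (_↭_)
open import Data.List.Relation.Unary.AllPairs using (AllPairs)
open import Data.Product using (_×_)
open import Data.Sum using (_⊎_)
open import Data.Empty using (⊥)
open import Relation.Unary using (Pred; _⊆_; _∩_; ∁; _∈_; _∉_)
  renaming (U to Univ)

record Signature : Set₁ where
  field
    Fun      : Set
    funArity : Fun → ℕ
    Rel      : Set
    relArity : Rel → ℕ

module MRL (Role : Set) (Sig : Signature) where
  open Signature Sig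

  RoleSet : Set₁
  RoleSet = Pred Role 0ℓ

  Endo : Set
  Endo = Role → Role

  preimage : Endo → RoleSet → RoleSet
  preimage f R = λ r → R (f r)

  record Filter : Set₁ where
    field
      mem   : RoleSet → Set
      full  : mem Univ
      up    : ∀ (R₁ R₂ : RoleSet) → mem R₁ → R₁ ⊆ R₂ → mem R₂
      inter : ∀ (R₁ R₂ : RoleSet) → mem R₁ → mem R₂ → mem (R₁ ∩ R₂)

  record Ultrafilter : Set₁ where
    field
      filter : Filter
    open Filter filter public
    field
      ultra : ∀ (R : RoleSet) → mem R ⊎ mem (∁ R)

  open Ultrafilter public using (mem)

  data Term : Set where
    var : ℕ → Term
    fn  : (g : Fun) → Vec Term (funArity g) → Term

  data Atom : Set where
    rel : (P : Rel) → Vec Term (relArity P) → Atom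

  -- MRL formulas; ∀ binds de Bruijn index 0.
  data Formula : Set₁ where
    atom : Atom → Formula
    ¬[_]_ : Endo → Formula → Formula
    _∧[_]_ : Formula → Ultrafilter → Formula → Formula
    imp : Endo → Ultrafilter → Formula → Formula → Formula
    all : Ultrafilter → Formula → Formula

  Subst : Set
  Subst = ℕ → Term

  mutual
    substT : Subst → Term → Term
    substT σ (var n) = σ n
    substT σ (fn g ts) = fn g (substTs σ ts)

    substTs : ∀ {n} → Subst → Vec Term n → Vec Term n
    substTs σ [] = []
    substTs σ (t ∷ ts) = substT σ t ∷ substTs σ ts

  shiftT : Term → Term
  shiftT = substT (λ n → var (suc n))

  lift : Subst → Subst
  lift σ zero = var zero
  lift σ (suc n) = shiftT (σ n)

  substA : Subst → Atom → Atom
  substA σ (rel P ts) = rel P (substTs σ ts)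

  substF : Subst → Formula → Formula
  substF σ (atom a) = atom (substA σ a)
  substF σ (¬[ f ] A) = ¬[ f ] substF σ A
  substF σ (A ∧[ U ] B) = substF σ A ∧[ U ] substF σ B
  substF σ (imp f U A B) = imp f U (substF σ A) (substF σ B)
  substF σ (all U A) = all U (substF (lift σ) A)

  inst : Formula → Term → Formula
  inst A t = substF (λ { zero → t ; (suc n) → var n }) A

  shiftF : Formula → Formula
  shiftF = substF (λ n → var (suc n))

  record IFormula : Set₁ where
    constructor [_]_
    field
      roles   : RoleSet
      formula : Formula

  shiftI : IFormula → IFormula
  shiftI ([ R ] A) = [ R ] shiftF A

  Sequent : Set₁
  Sequent = List IFormula

  Partition : List RoleSet → Set₁
  Partition Rs = (∀ r → Any (λ R → r ∈ R) Rs)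
               × AllPairs (λ R S → ∀ r → r ∈ R → r ∈ S → ⊥) Rs

  data ⊢_ : Sequent → Set₁ where
    perm  : ∀ {Γ Δ} → Γ ↭ Δ → ⊢ Γ → ⊢ Δ      -- sequents are multisets
    id    : ∀ Γ a (R₀ : RoleSet) (Rs : List RoleSet) → Partition (R₀ ∷ Rs) →
            ⊢ (Γ ++ map (λ R → [ R ] atom a) (R₀ ∷ Rs))
    contr : ∀ {Γ R A} → ⊢ (Γ ++ [ R ] A ∷ [ R ] A ∷ []) → ⊢ (Γ ++ [ R ] A ∷ [])
    neg   : ∀ {Γ R f A} → ⊢ (Γ ++ [ preimage f R ] A ∷ []) → ⊢ (Γ ++ [ R ] (¬[ f ] A) ∷ [])
    and-neg₁ : ∀ {Γ R U A B} → R ∉ mem U → ⊢ (Γ ++ [ R ] A ∷ []) →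
               ⊢ (Γ ++ [ R ] (A ∧[ U ] B) ∷ [])
    and-neg₂ : ∀ {Γ R U A B} → R ∉ mem U → ⊢ (Γ ++ [ R ] B ∷ []) →
               ⊢ (Γ ++ [ R ] (A ∧[ U ] B) ∷ [])
    and-pos  : ∀ {Γ R U A B} → R ∈ mem U → ⊢ (Γ ++ [ R ] A ∷ []) → ⊢ (Γ ++ [ R ] B ∷ []) →
               ⊢ (Γ ++ [ R ] (A ∧[ U ] B) ∷ [])
    imp-neg  : ∀ {Γ R f U A B} → R ∉ mem U →
               ⊢ (Γ ++ [ preimage f R ] A ∷ [ R ] B ∷ []) →
               ⊢ (Γ ++ [ R ] imp f U A B ∷ [])
    imp-pos  : ∀ {Γ₁ Γ₂ R f U A B} → R ∈ mem U →
               ⊢ (Γ₁ ++ [ preimage f R ] A ∷ []) → ⊢ (Γ₂ ++ [ R ] B ∷ []) →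
               ⊢ (Γ₁ ++ Γ₂ ++ [ R ] imp f U A B ∷ [])
    all-neg  : ∀ {Γ R U A} (t : Term) → R ∉ mem U → ⊢ (Γ ++ [ R ] inst A t ∷ []) →
               ⊢ (Γ ++ [ R ] all U A ∷ [])
    -- eigenvariable condition in de Bruijn form: Γ is shifted so index 0 is fresh
    all-pos  : ∀ {Γ R U A} → R ∈ mem U → ⊢ (map shiftI Γ ++ [ R ] A ∷ []) →
               ⊢ (Γ ++ [ R ] all U A ∷ [])

-- Weakening is pushed up the derivation: [R]A is added to the context of the
-- last rule, which every rule carries along unchanged. Only two rules need care:
-- (⊃-pos) splits its context, so [R]A goes into one premise only, and (∀-pos)
-- shifts its context past the eigenvariable, so there the premise is weakened
-- by the shifted formula. The axiom (Id) admits any side context directly.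
module Submission where

open import Defs
open import Data.List using (List; []; _∷_; _++_; map)
open import Data.List.Properties using (map-++)
import Data.List.Properties as List
open import Data.List.Relation.Binary.Permutation.Propositional
  using (_↭_; ↭-trans; ↭-reflexive; module PermutationReasoning)
open import Data.List.Relation.Binary.Permutation.Propositional.Properties
  using (++⁺ˡ; ++⁺ʳ; ++-comm; ++-assoc)
open import Relation.Binary.PropositionalEquality using (subst; sym)

swap-tail : ∀ {a} {X : Set a} (Γ Δ Θ : List X) → (Γ ++ Δ) ++ Θ ↭ (Γ ++ Θ) ++ Δ
swap-tail Γ Δ Θ = begin
  (Γ ++ Δ) ++ Θ  ↭⟨ ++-assoc Γ Δ Θ ⟩
  Γ ++ (Δ ++ Θ)  ↭⟨ ++⁺ˡ Γ (++-comm Δ Θ) ⟩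
  Γ ++ (Θ ++ Δ)  ↭⟨ ++-assoc Γ Θ Δ ⟨
  (Γ ++ Θ) ++ Δ  ∎
  where open PermutationReasoning

module _ {Role : Set} {Sig : Signature} where
  open MRL Role Sig

  ⊢-swap-tail : ∀ Γ {Δ Θ} → ⊢ ((Γ ++ Δ) ++ Θ) → ⊢ ((Γ ++ Θ) ++ Δ)
  ⊢-swap-tail Γ = perm (swap-tail Γ _ _)

  ⊢-weaken : ∀ {Γ} R A → ⊢ Γ → ⊢ (Γ ++ [ R ] A ∷ [])
  ⊢-weaken R A (perm p d) = perm (++⁺ʳ _ p) (⊢-weaken R A d)
  ⊢-weaken R A (id Γ a R₀ Rs P) = ⊢-swap-tail Γ (id (Γ ++ [ R ] A ∷ []) a R₀ Rs P)
  ⊢-weaken R A (contr {Γ} d) =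
    ⊢-swap-tail Γ (contr (⊢-swap-tail Γ (⊢-weaken R A d)))
  ⊢-weaken R A (neg {Γ} d) =
    ⊢-swap-tail Γ (neg (⊢-swap-tail Γ (⊢-weaken R A d)))
  ⊢-weaken R A (and-neg₁ {Γ} R∉U d) =
    ⊢-swap-tail Γ (and-neg₁ R∉U (⊢-swap-tail Γ (⊢-weaken R A d)))
  ⊢-weaken R A (and-neg₂ {Γ} R∉U d) =
    ⊢-swap-tail Γ (and-neg₂ R∉U (⊢-swap-tail Γ (⊢-weaken R A d)))
  ⊢-weaken R A (and-pos {Γ} R∈U d e) = ⊢-swap-tail Γ
    (and-pos R∈U (⊢-swap-tail Γ (⊢-weaken R A d)) (⊢-swap-tail Γ (⊢-weaken R A e)))
  ⊢-weaken R A (imp-neg {Γ} R∉U d) =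
    ⊢-swap-tail Γ (imp-neg R∉U (⊢-swap-tail Γ (⊢-weaken R A d)))
  ⊢-weaken R A (imp-pos {Γ₁} {Γ₂} R∈U d e) =
    perm (↭-trans (++⁺ˡ Γ₁ (swap-tail Γ₂ _ _)) (↭-reflexive (sym (List.++-assoc Γ₁ _ _))))
      (imp-pos R∈U d (⊢-swap-tail Γ₂ (⊢-weaken R A e)))
  ⊢-weaken R A (all-neg {Γ} t R∉U d) =
    ⊢-swap-tail Γ (all-neg t R∉U (⊢-swap-tail Γ (⊢-weaken R A d)))
  ⊢-weaken R A (all-pos {Γ} {R′} {U} {B} R∈U d) = ⊢-swap-tail Γ
    (all-pos R∈U (subst (λ Δ → ⊢ (Δ ++ [ R′ ] B ∷ [])) (sym (map-++ shiftI Γ _))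
      (⊢-swap-tail (map shiftI Γ) (⊢-weaken R (shiftF A) d))))

lemma1 : (Role : Set) (Sig : Signature) →
    (Γ : MRL.Sequent Role Sig) (R : MRL.RoleSet Role Sig) (A : MRL.Formula Role Sig) →
    MRL.⊢_ Role Sig Γ → MRL.⊢_ Role Sig (Γ ++ MRL.[_]_ R A ∷ [])
lemma1 Role Sig Γ R A = ⊢-weaken R A
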